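{- Let $b_1,\dots,b_k$ be nonnegative integers with $\sum_{i=1}^k 1/2^{b_i}\ge 1$. Then $(2^{b_1},\dots,2^{b_k})$ is good.
   Context: A tuple $(a_1,\dots,a_k)$ of positive integers is good if there are sets $S_1,\dots,S_k\subseteq\mathbb{R}$ such that any two distinct elements of $S_i$ differ by at least $a_i$ and every integer belongs to $S_1\cup\dots\cup S_k$; otherwise it is bad. -}

module Defs where

open import Data.Nat using (ℕ; zero; suc; _^_; _≤_)
open import Data.Nat.Properties using (m^n≢0)
open import Data.Integer as ℤ using (ℤ; +_; _-_; ∣_∣)
open import Data.Rational as ℚ using (ℚ)
open import Data.Fin using (Fin; zero; suc)
open import Data.Product using (Σ; ∃; _×_)
open import Relation.Binary.PropositionalEquality using (_≢_)

-- The sets S_i are taken as predicates on ℤ.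
-- A tuple (a_1,…,a_k) is represented as a : Fin k → ℕ.
Good : (k : ℕ) → (Fin k → ℕ) → Set₁
Good k a =
  Σ (Fin k → ℤ → Set) λ S →
    (∀ i x y → S i x → S i y → x ≢ y → a i ≤ ∣ x - y ∣)
    × (∀ (n : ℤ) → ∃ λ i → S i n)

inv2^ : ℕ → ℚ
inv2^ b = ℚ._/_ (+ 1) (2 ^ b) {{m^n≢0 2 b}}

sumFin : (k : ℕ) → (Fin k → ℚ) → ℚ
sumFin zero    f = ℚ.0ℚ
sumFin (suc k) f = f zero ℚ.+ sumFin k (λ i → f (suc i))

module Submission where

-- Take classes r i modulo 2 ^ b i covering ℤ: two distinct members of one class differ by at least
-- 2 ^ b i. With B ≥ every b i the hypothesis reads Σ 2 ^ (B - b i) ≥ 2 ^ B, and the classes are built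
-- by induction on k, with a largest exponent 1 + t moved to the front. If 1 + t occurs twice, cover with
-- the two entries replaced by one entry t (same weight) and split that class modulo 2 ^ t into two
-- classes modulo 2 ^ (1 + t). If it occurs once, every other term and 2 ^ B are multiples of
-- 2 ^ (B - t), so the lone term 2 ^ (B - t - 1) is not needed and the entry is dropped. An exponent 0
-- covers ℤ by itself.

open import Defs
open import Data.Nat using (ℕ; _^_)
open import Data.Fin using (Fin)

module _ where
  open import Data.Nat using (zero; suc; _+_; _*_; _∸_; _≤_; _<_; NonZero; ≢-nonZero; s≤s; s≤s⁻¹)
  open import Data.Nat.Properties
  import Data.Nat.Divisibility as ℕ
  open import Data.Integer as ℤ using (ℤ; +_; 0ℤ)
  import Data.Integer.Properties as ℤ
  import Data.Integer.DivMod as ℤ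
  import Data.Integer.Divisibility.Signed as ℤ
  open import Data.Integer.Tactic.RingSolver using (solve-∀)
  import Data.Rational as ℚ
  import Data.Rational.Properties as ℚ
  open import Data.Rational.Unnormalised as ℚᵘ using (mkℚᵘ; _≃_; *≡*; *≤*)
  import Data.Rational.Unnormalised.Properties as ℚᵘ
  open import Data.Fin using (zero; suc)
  open import Data.Fin.Patterns using (0F; 1F)
  open import Data.Fin.Properties using (any?)
  open import Data.Fin.Permutation using (Permutation′; _⟨$⟩ʳ_; _⟨$⟩ˡ_; inverseˡ; transpose)
  open import Data.Vec.Functional using (_∷_; tail)
  import Data.List as List
  open import Data.List.Extrema.Nat using (argmax; f[xs]≤f[argmax]; max; xs≤max)
  import Data.List.Relation.Unary.All.Properties as All
  open import Algebra.Properties.CommutativeMonoid.Sum +-0-commutativeMonoid using (sum; sum-permute)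
  open import Data.Product using (Σ; ∃; _,_; proj₁; proj₂)
  open import Data.Sum using (_⊎_; inj₁; inj₂)
  open import Function using (_∘_)
  open import Relation.Nullary using (yes; no; contradiction)
  open import Relation.Binary.PropositionalEquality

  2^-mono-∣ : ∀ {m n} → m ≤ n → 2 ^ m ℕ.∣ 2 ^ n
  2^-mono-∣ {m} {n} m≤n = subst (2 ^ m ℕ.∣_) 2^m*2^[n∸m]≡2^n (ℕ.m∣m*n (2 ^ (n ∸ m)))
    where
    2^m*2^[n∸m]≡2^n : 2 ^ m * 2 ^ (n ∸ m) ≡ 2 ^ n
    2^m*2^[n∸m]≡2^n = trans (sym (^-distribˡ-+-* 2 m (n ∸ m))) (cong (2 ^_) (m+[n∸m]≡n m≤n))

  multiples-≤-absorb : ∀ {m x y d} → m ℕ.∣ x → m ℕ.∣ y → x ≤ d + y → d < m → x ≤ y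
  multiples-≤-absorb {m} (ℕ.divides-refl p) (ℕ.divides-refl q) x≤d+y d<m =
    *-monoˡ-≤ m (s≤s⁻¹ (*-cancelʳ-< m p (suc q) (≤-<-trans x≤d+y (+-monoˡ-< (q * m) d<m))))

  ∣-sum : ∀ {m k} (f : Fin k → ℕ) → (∀ i → m ℕ.∣ f i) → m ℕ.∣ sum f
  ∣-sum {m} {zero}  f _   = m ℕ.∣0
  ∣-sum {k = suc k} f m∣f = ℕ.∣m∣n⇒∣m+n (m∣f 0F) (∣-sum (tail f) (m∣f ∘ suc))

  ∃-argmax : ∀ {k} (b : Fin (suc k) → ℕ) → ∃ λ j → ∀ i → b i ≤ b j
  ∃-argmax {k} b =
    argmax b 0F (List.allFin (suc k)) , All.tabulate⁻ (f[xs]≤f[argmax] {f = b} 0F (List.allFin (suc k)))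

  ∃-upper-bound : ∀ {k} (b : Fin k → ℕ) → ∃ λ B → ∀ i → b i ≤ B
  ∃-upper-bound b = max 0 (List.tabulate b) , All.tabulate⁻ (xs≤max 0 (List.tabulate b))

  -- For b i ≤ B this is 2^B times the sum of 2^(-b i); beyond B the truncated subtraction makes a term 1.
  weight : ∀ {k} → ℕ → (Fin k → ℕ) → ℕ
  weight B b = sum (λ i → 2 ^ (B ∸ b i))

  weight-permute : ∀ {k} B (b : Fin k → ℕ) (π : Permutation′ k) → weight B (b ∘ (π ⟨$⟩ʳ_)) ≡ weight B b
  weight-permute B b π = sym (sum-permute (λ i → 2 ^ (B ∸ b i)) π)

  weight-drop : ∀ {k t} B (b : Fin (suc k) → ℕ) → b 0F ≡ suc t → (∀ i → b (suc i) ≤ t) → t < B →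
                2 ^ B ≤ weight B b → 2 ^ B ≤ weight B (tail b)
  weight-drop {t = t} B b b₀≡1+t b≤t t<B 2^B≤w =
    multiples-≤-absorb 2^[B∸t]∣2^B 2^[B∸t]∣weight 2^B≤w′ (^-monoʳ-< 2 (n<1+n 1) (∸-monoʳ-< (n<1+n t) t<B))
    where
    2^[B∸t]∣2^B : 2 ^ (B ∸ t) ℕ.∣ 2 ^ B
    2^[B∸t]∣2^B = 2^-mono-∣ (m∸n≤m B t)
    2^[B∸t]∣weight : 2 ^ (B ∸ t) ℕ.∣ weight B (tail b)
    2^[B∸t]∣weight = ∣-sum _ (λ i → 2^-mono-∣ (∸-monoʳ-≤ B (b≤t i)))
    2^B≤w′ : 2 ^ B ≤ 2 ^ (B ∸ suc t) + weight B (tail b)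
    2^B≤w′ = subst (λ a → 2 ^ B ≤ 2 ^ (B ∸ a) + weight B (tail b)) b₀≡1+t 2^B≤w

  weight-merge : ∀ {k t} B (b : Fin (suc (suc k)) → ℕ) → b 0F ≡ suc t → b 1F ≡ suc t → t < B →
                 weight B (t ∷ tail (tail b)) ≡ weight B b
  weight-merge {t = t} B b b₀≡1+t b₁≡1+t t<B = begin
    2 ^ (B ∸ t) + W         ≡⟨ cong (λ e → 2 ^ e + W) (+-∸-assoc 1 t<B) ⟩
    2 ^ suc (B ∸ suc t) + W ≡⟨⟩
    (x + (x + 0)) + W       ≡⟨ cong (λ y → (x + y) + W) (+-identityʳ x) ⟩
    (x + x) + W             ≡⟨ +-assoc x x W ⟩
    x + (x + W)             ≡⟨ cong₂ (λ a c → 2 ^ (B ∸ a) + (2 ^ (B ∸ c) + W)) b₀≡1+t b₁≡1+t ⟨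
    weight B b              ∎
    where
    open ≡-Reasoning
    x = 2 ^ (B ∸ suc t)
    W = weight B (tail (tail b))

  toℚᵘ-/ : ∀ i d .{{_ : NonZero d}} → ℚ.toℚᵘ (i ℚ./ d) ≃ i ℚᵘ./ d
  toℚᵘ-/ i (suc d) = ℚ.toℚᵘ-fromℚᵘ (mkℚᵘ i d)

  +-/ : ∀ i j d .{{_ : NonZero d}} → i ℚᵘ./ d ℚᵘ.+ j ℚᵘ./ d ≃ (i ℤ.+ j) ℚᵘ./ d
  +-/ i j (suc d) = *≡* (trans (distrib i j (+ suc d)) (cong ((i ℤ.+ j) ℤ.*_) (sym (ℤ.pos-* (suc d) (suc d)))))
    where
    distrib : ∀ i j d → (i ℤ.* d ℤ.+ j ℤ.* d) ℤ.* d ≡ (i ℤ.+ j) ℤ.* (d ℤ.* d)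
    distrib = solve-∀

  toℚᵘ-inv2^ : ∀ {b} B → b ≤ B → ℚ.toℚᵘ (inv2^ b) ≃ (+ (2 ^ (B ∸ b)) ℚᵘ./ 2 ^ B) {{m^n≢0 2 B}}
  toℚᵘ-inv2^ {b} B b≤B = ℚᵘ.≃-trans (toℚᵘ-/ (+ 1) (2 ^ b)) (*≡* (begin
    ℚᵘ.↥ (+ 1 ℚᵘ./ 2 ^ b) ℤ.* ℚᵘ.↧ (+ (2 ^ (B ∸ b)) ℚᵘ./ 2 ^ B)
      ≡⟨ cong₂ ℤ._*_ (ℚᵘ.↥[n/d]≡n (+ 1) (2 ^ b)) (ℚᵘ.↧[n/d]≡d _ (2 ^ B)) ⟩
    + 1 ℤ.* + (2 ^ B)                 ≡⟨ ℤ.*-identityˡ _ ⟩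
    + (2 ^ B)                         ≡⟨ cong +_ 2^B≡2^[B∸b]*2^b ⟩
    + (2 ^ (B ∸ b) * 2 ^ b)           ≡⟨ ℤ.pos-* (2 ^ (B ∸ b)) (2 ^ b) ⟩
    + (2 ^ (B ∸ b)) ℤ.* + (2 ^ b)
      ≡⟨ cong₂ ℤ._*_ (ℚᵘ.↥[n/d]≡n _ (2 ^ B)) (ℚᵘ.↧[n/d]≡d (+ 1) (2 ^ b)) ⟨
    ℚᵘ.↥ (+ (2 ^ (B ∸ b)) ℚᵘ./ 2 ^ B) ℤ.* ℚᵘ.↧ (+ 1 ℚᵘ./ 2 ^ b) ∎))
    where
    open ≡-Reasoning
    instance
      _ = m^n≢0 2 b
      _ = m^n≢0 2 B
    2^B≡2^[B∸b]*2^b : 2 ^ B ≡ 2 ^ (B ∸ b) * 2 ^ b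
    2^B≡2^[B∸b]*2^b = trans (cong (2 ^_) (sym (m∸n+n≡m b≤B))) (^-distribˡ-+-* 2 (B ∸ b) b)

  toℚᵘ-sumFin : ∀ {k} d .{{_ : NonZero d}} (f : Fin k → ℚ.ℚ) (g : Fin k → ℕ) →
                (∀ i → ℚ.toℚᵘ (f i) ≃ + g i ℚᵘ./ d) → ℚ.toℚᵘ (sumFin k f) ≃ + sum g ℚᵘ./ d
  toℚᵘ-sumFin {zero}  (suc d) f g _    = *≡* refl
  toℚᵘ-sumFin {suc k} d       f g f≃g/d = begin
    ℚ.toℚᵘ (f 0F ℚ.+ sumFin k (tail f))                 ≈⟨ ℚ.toℚᵘ-homo-+ (f 0F) (sumFin k (tail f)) ⟩
    ℚ.toℚᵘ (f 0F) ℚᵘ.+ ℚ.toℚᵘ (sumFin k (tail f))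
      ≈⟨ ℚᵘ.+-cong (f≃g/d 0F) (toℚᵘ-sumFin d (tail f) (tail g) (f≃g/d ∘ suc)) ⟩
    + g 0F ℚᵘ./ d ℚᵘ.+ + sum (tail g) ℚᵘ./ d             ≈⟨ +-/ (+ g 0F) (+ sum (tail g)) d ⟩
    (+ g 0F ℤ.+ + sum (tail g)) ℚᵘ./ d                   ≡⟨ cong (λ i → i ℚᵘ./ d) (ℤ.pos-+ (g 0F) (sum (tail g))) ⟨
    + sum g ℚᵘ./ d                                       ∎
    where open ℚᵘ.≃-Reasoning

  1≤n/d⇒d≤n : ∀ {n} d .{{_ : NonZero d}} → ℚᵘ.1ℚᵘ ℚᵘ.≤ + n ℚᵘ./ d → d ≤ n
  1≤n/d⇒d≤n (suc d) (*≤* 1*d≤n*1) = ℤ.drop‿+≤+ (subst₂ ℤ._≤_ (ℤ.*-identityˡ _) (ℤ.*-identityʳ _) 1*d≤n*1)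

  1≤sumFin⇒2^B≤weight : ∀ {k} B (b : Fin k → ℕ) → (∀ i → b i ≤ B) →
                         ℚ.1ℚ ℚ.≤ sumFin k (λ i → inv2^ (b i)) → 2 ^ B ≤ weight B b
  1≤sumFin⇒2^B≤weight B b b≤B 1≤∑ = 1≤n/d⇒d≤n (2 ^ B)
    (ℚᵘ.≤-respʳ-≃ (toℚᵘ-sumFin (2 ^ B) _ _ (λ i → toℚᵘ-inv2^ B (b≤B i))) (ℚ.toℚᵘ-mono-≤ 1≤∑))
    where
    instance
      _ = m^n≢0 2 B

  Covering : ∀ {k} → (Fin k → ℕ) → Set
  Covering {k} b = Σ (Fin k → ℤ) λ r → ∀ n → ∃ λ i → + (2 ^ b i) ℤ.∣ n ℤ.- r i

  covering-resp-≗ : ∀ {k} {b c : Fin k → ℕ} → b ≗ c → Covering b → Covering c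
  covering-resp-≗ b≗c (r , cover) = r , λ n →
    let i , 2^bᵢ∣n-rᵢ = cover n in i , subst (λ e → + (2 ^ e) ℤ.∣ n ℤ.- r i) (b≗c i) 2^bᵢ∣n-rᵢ

  covering-permute : ∀ {k} (b : Fin k → ℕ) (π : Permutation′ k) → Covering (b ∘ (π ⟨$⟩ʳ_)) → Covering b
  covering-permute b π (r , cover) = r ∘ (π ⟨$⟩ˡ_) , λ n →
    let i , d = cover n
    in π ⟨$⟩ʳ i , subst (λ j → + (2 ^ b (π ⟨$⟩ʳ i)) ℤ.∣ n ℤ.- r j) (sym (inverseˡ π)) d

  covering-trivial : ∀ {k} (b : Fin k → ℕ) i → b i ≡ 0 → Covering b
  covering-trivial b i bᵢ≡0 = (λ _ → 0ℤ) , λ n →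
    i , subst (λ e → + (2 ^ e) ℤ.∣ n ℤ.- 0ℤ) (sym bᵢ≡0) (ℤ.∣ᵤ⇒∣ (ℕ.1∣ _))

  covering-tail : ∀ {k} (b : Fin (suc k) → ℕ) → Covering (tail b) → Covering b
  covering-tail b (r , cover) = 0ℤ ∷ r , λ n → let i , d = cover n in suc i , d

  even⊎odd : ∀ q → ∃ λ h → q ≡ h ℤ.* + 2 ⊎ q ≡ + 1 ℤ.+ h ℤ.* + 2
  even⊎odd q with q ℤ.%ℕ 2 | ℤ.n%ℕd<d q 2 | ℤ.a≡a%ℕn+[a/ℕn]*n q 2
  ... | 0           | _             | q≡0+2h = q ℤ./ℕ 2 , inj₁ (trans q≡0+2h (ℤ.+-identityˡ _))
  ... | 1           | _             | q≡1+2h = q ℤ./ℕ 2 , inj₂ q≡1+2h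
  ... | suc (suc _) | s≤s (s≤s ()) | _

  m∣i⇒2m∣i⊎2m∣i-m : ∀ {m i} → + m ℤ.∣ i → + (2 * m) ℤ.∣ i ⊎ + (2 * m) ℤ.∣ i ℤ.- + m
  m∣i⇒2m∣i⊎2m∣i-m {m} (ℤ.divides q refl) with even⊎odd q
  ... | h , inj₁ refl = inj₁ (ℤ.divides h (trans (ℤ.*-assoc h (+ 2) (+ m)) h[2m]≡h*2m))
    where
    h[2m]≡h*2m : h ℤ.* (+ 2 ℤ.* + m) ≡ h ℤ.* + (2 * m)
    h[2m]≡h*2m = cong (h ℤ.*_) (sym (ℤ.pos-* 2 m))
  ... | h , inj₂ refl = inj₂ (ℤ.divides h (trans ([1+2h]m-m≡h[2m] h (+ m)) h[2m]≡h*2m))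
    where
    [1+2h]m-m≡h[2m] : ∀ h m → (+ 1 ℤ.+ h ℤ.* + 2) ℤ.* m ℤ.- m ≡ h ℤ.* (+ 2 ℤ.* m)
    [1+2h]m-m≡h[2m] = solve-∀
    h[2m]≡h*2m : h ℤ.* (+ 2 ℤ.* + m) ≡ h ℤ.* + (2 * m)
    h[2m]≡h*2m = cong (h ℤ.*_) (sym (ℤ.pos-* 2 m))

  covering-split : ∀ {k} t (b : Fin k → ℕ) → Covering (t ∷ b) → Covering (suc t ∷ suc t ∷ b)
  covering-split t b (r , cover) = r′ , cover′
    where
    r′ : Fin (suc (suc _)) → ℤ
    r′ = r 0F ∷ (r 0F ℤ.+ + (2 ^ t)) ∷ tail r
    [n-r]-m≡n-[r+m] : ∀ n r m → n ℤ.- r ℤ.- m ≡ n ℤ.- (r ℤ.+ m)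
    [n-r]-m≡n-[r+m] = solve-∀
    cover′ : ∀ n → ∃ λ i → + (2 ^ (suc t ∷ suc t ∷ b) i) ℤ.∣ n ℤ.- r′ i
    cover′ n with cover n
    ... | suc i , d = suc (suc i) , d
    ... | zero  , d with m∣i⇒2m∣i⊎2m∣i-m d
    ...   | inj₁ d′ = 0F , d′
    ...   | inj₂ d′ = 1F , subst (+ (2 ^ suc t) ℤ.∣_) ([n-r]-m≡n-[r+m] n (r 0F) (+ (2 ^ t))) d′

  WeightCovers : ℕ → ℕ → Set
  WeightCovers B k = (b : Fin k → ℕ) → (∀ i → b i ≤ B) → 2 ^ B ≤ weight B b → Covering b

  covering-drop : ∀ {B k t} → WeightCovers B k → (b : Fin (suc k) → ℕ) → (∀ i → b i ≤ B) →
                  2 ^ B ≤ weight B b → b 0F ≡ suc t → (∀ i → b (suc i) ≤ t) → Covering b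
  covering-drop {B} IH b b≤B 2^B≤w b₀≡1+t b≤t =
    covering-tail b (IH (tail b) (b≤B ∘ suc) (weight-drop B b b₀≡1+t b≤t t<B 2^B≤w))
    where
    t<B = subst (_≤ B) b₀≡1+t (b≤B 0F)

  covering-merge : ∀ {B k t} → WeightCovers B k → (b : Fin (suc k) → ℕ) → (∀ i → b i ≤ B) →
                   2 ^ B ≤ weight B b → b 0F ≡ suc t → (p : Fin k) → b (suc p) ≡ suc t → Covering b
  covering-merge {B} {suc _} {t} IH b b≤B 2^B≤w b₀≡1+t p bₚ≡1+t =
    covering-permute b σ (covering-resp-≗ twins-first (covering-split t rest (IH (t ∷ rest) t∷rest≤B 2^B≤w′)))
    where
    σ = transpose 1F (suc p)
    c = b ∘ (σ ⟨$⟩ʳ_)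
    rest = tail (tail c)
    t<B : t < B
    t<B = subst (_≤ B) b₀≡1+t (b≤B 0F)
    twins-first : (suc t ∷ suc t ∷ rest) ≗ c
    twins-first 0F            = sym b₀≡1+t
    twins-first 1F            = sym bₚ≡1+t
    twins-first (suc (suc i)) = refl
    t∷rest≤B : ∀ i → (t ∷ rest) i ≤ B
    t∷rest≤B 0F      = <⇒≤ t<B
    t∷rest≤B (suc i) = b≤B _
    2^B≤w′ : 2 ^ B ≤ weight B (t ∷ rest)
    2^B≤w′ = subst (2 ^ B ≤_) (sym (trans (weight-merge B c b₀≡1+t bₚ≡1+t t<B) (weight-permute B b σ))) 2^B≤w

  covering-maxFirst : ∀ {B k m} → WeightCovers B k → (b : Fin (suc k) → ℕ) → b 0F ≡ m → (∀ i → b i ≤ m) →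
                      (∀ i → b i ≤ B) → 2 ^ B ≤ weight B b → Covering b
  covering-maxFirst {m = zero}  IH b b₀≡0    _      b≤B 2^B≤w = covering-trivial b 0F b₀≡0
  covering-maxFirst {m = suc t} IH b b₀≡1+t b≤1+t b≤B 2^B≤w with any? (λ p → b (suc p) ≟ suc t)
  ... | yes (p , bₚ≡1+t) = covering-merge IH b b≤B 2^B≤w b₀≡1+t p bₚ≡1+t
  ... | no  no-twin      =
    covering-drop IH b b≤B 2^B≤w b₀≡1+t (λ i → s≤s⁻¹ (≤∧≢⇒< (b≤1+t (suc i)) (no-twin ∘ (i ,_))))

  covering : ∀ {k} B → WeightCovers B k
  covering {zero}  B b _ 2^B≤0 = contradiction 2^B≤0 (<⇒≱ (m^n>0 2 B))
  covering {suc k} B b b≤B 2^B≤w =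
    covering-permute b π (covering-maxFirst (covering B) (b ∘ (π ⟨$⟩ʳ_)) refl (b≤bⱼ ∘ (π ⟨$⟩ʳ_)) (b≤B ∘ (π ⟨$⟩ʳ_))
      (subst (2 ^ B ≤_) (sym (weight-permute B b π)) 2^B≤w))
    where
    j = proj₁ (∃-argmax b)
    b≤bⱼ = proj₂ (∃-argmax b)
    π = transpose 0F j

  same-class⇒≤∣-∣ : ∀ {d r x y} → + d ℤ.∣ x ℤ.- r → + d ℤ.∣ y ℤ.- r → x ≢ y → d ≤ ℤ.∣ x ℤ.- y ∣
  same-class⇒≤∣-∣ {d} {r} {x} {y} d∣x-r d∣y-r x≢y =
    ℕ.∣⇒≤ {{≢-nonZero ∣x-y∣≢0}} (ℤ.∣⇒∣ᵤ (subst (+ d ℤ.∣_) ([x-r]-[y-r]≡x-y x y r) (ℤ.∣m∣n⇒∣m-n d∣x-r d∣y-r)))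
    where
    [x-r]-[y-r]≡x-y : ∀ x y r → (x ℤ.- r) ℤ.- (y ℤ.- r) ≡ x ℤ.- y
    [x-r]-[y-r]≡x-y = solve-∀
    ∣x-y∣≢0 : ℤ.∣ x ℤ.- y ∣ ≢ 0
    ∣x-y∣≢0 = x≢y ∘ ℤ.i-j≡0⇒i≡j x y ∘ ℤ.∣i∣≡0⇒i≡0

  covering⇒Good : ∀ {k} (b : Fin k → ℕ) → Covering b → Good k (λ i → 2 ^ b i)
  covering⇒Good b (r , cover) = (λ i x → + (2 ^ b i) ℤ.∣ x ℤ.- r i) , (λ i x y → same-class⇒≤∣-∣) , cover

open import Data.Product using (_,_)
open import Data.Rational using (_≤_; 1ℚ)

lemma5 : (k : ℕ) (b : Fin k → ℕ) →
    1ℚ ≤ sumFin k (λ i → inv2^ (b i)) →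
    Good k (λ i → 2 ^ b i)
lemma5 k b 1≤∑ =
  let B , b≤B = ∃-upper-bound b
  in covering⇒Good b (covering B b b≤B (1≤sumFin⇒2^B≤weight B b b≤B 1≤∑))
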